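{- Let $s\in\mathbb{N}$ and $n=R(s,s)$. Let $e$ be an edge of $K_n$ and suppose the edges of $K_n-e$ are colored with two colors $1,2$ so that there is no monochromatic subgraph isomorphic to $K_s$. For $i\in\{1,2\}$, extend this coloring by giving $e$ color $i$, and let $G_i$ be the subgraph of $K_n$ whose vertices are the vertices of the monochromatic (color $i$) copies of $K_s$ containing $e$, and whose edges are the edges of color $i$ incident to those vertices. Then $$\bigl|\,|V(G_1)|-|V(G_2)|\,\bigr|<R(s-1,s)-(s-2).$$
   Context: $K_n$ is the complete graph on $n$ vertices and $K_n-e$ is $K_n$ with the edge $e$ deleted. $R(a,b)$ denotes the two-color Ramsey number: the least $n$ such that every coloring of the edges of $K_n$ with colors $1,2$ contains a $K_a$ all of whose edges have color $1$ or a $K_b$ all of whose edges have color $2$. -}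

module Defs where

open import Data.Nat using (ℕ; _≤_; _∸_)
open import Data.Fin using (Fin; _<_; _≟_)
open import Data.Fin.Subset using (Subset; _∈_; ∣_∣)
open import Data.Product using (Σ; ∃; _×_)
open import Data.Sum using (_⊎_)
open import Relation.Nullary using (¬_; yes; no)
open import Relation.Binary.PropositionalEquality using (_≡_)

-- Colours 1,2 are represented by Fin 2 (zero ↦ colour 1, suc zero ↦ colour 2).
Colour : Set
Colour = Fin 2

-- A 2-colouring of the edges of K_n: the edge {x,y} with x < y gets colour c x y.
-- (Values c x y with x ≥ y are irrelevant.)
Colouring : ℕ → Set
Colouring n = Fin n → Fin n → Colour

MonoClique : ∀ {n} → Colouring n → Colour → Subset n → Set
MonoClique c col S = ∀ x y → x ∈ S → y ∈ S → x < y → c x y ≡ col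

HasMonoK : ∀ {n} → Colouring n → Colour → ℕ → Set
HasMonoK {n} c col k = Σ (Subset n) λ S → ∣ S ∣ ≡ k × MonoClique c col S

Arrows : ℕ → ℕ → ℕ → Set
Arrows a b n = (c : Colouring n) → HasMonoK c Fin.zero a ⊎ HasMonoK c (Fin.suc Fin.zero) b

IsRamsey : ℕ → ℕ → ℕ → Set
IsRamsey a b n = Arrows a b n × (∀ m → Arrows a b m → n ≤ m)

extend : ∀ {n} → Colouring n → Fin n → Fin n → Colour → Colouring n
extend c u v i x y with x ≟ u | y ≟ v
... | yes _ | yes _ = i
... | _     | _     = c x y

-- c, viewed as a colouring of K_n - e (e = {u,v}), has no monochromatic K_s:
-- no s-set not containing both u and v is a monochromatic clique
NoMonoKsMinusEdge : ∀ {n} → ℕ → Colouring n → Fin n → Fin n → Set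
NoMonoKsMinusEdge {n} s c u v =
  ∀ (S : Subset n) (col : Colour) → ∣ S ∣ ≡ s → ¬ (u ∈ S × v ∈ S) → ¬ MonoClique c col S

InG : ∀ {n} → ℕ → Colouring n → Fin n → Fin n → Colour → Fin n → Set
InG {n} s c u v i w =
  Σ (Subset n) λ S → ∣ S ∣ ≡ s × u ∈ S × v ∈ S × w ∈ S × MonoClique (extend c u v i) i S

{-# OPTIONS --safe #-}
-- Give e colour i. Since n = R(s,s) there is a monochromatic K_s, and as the colouring of
-- K_n − e has none, it contains both ends u, v of e; so it has colour i and |V(Gᵢ)| ≥ s ≥ 2.
-- Every vertex w of Gᵢ other than u, v lies on a colour-i K_s through u, hence uw has colour i.
-- So Gᵢ − {u,v} contains neither a colour-i K_(s−1) (adding u gives a colour-i K_s avoiding v)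
-- nor a K_s of the other colour (it avoids u); thus it has fewer than R(s−1,s) vertices and
-- |V(Gᵢ)| ≤ R(s−1,s) + 1. Two numbers in [s, R(s−1,s) + 1] differ by less than R(s−1,s) − (s−2).
module Submission where

open import Defs
open import Data.Nat using (ℕ; _∸_; ∣_-_∣)
open import Data.Nat as N using ()
open import Data.Fin using (Fin; zero; suc; _<_)
open import Data.Fin.Subset using (Subset; _∈_; ∣_∣)
open import Function.Bundles using (_⇔_)

open import Data.Nat using (_≤_; z≤n; s≤s)
open import Data.Nat.Properties
  using (≤-refl; ≤-trans; ≤-reflexive; ≤-<-trans; n≤1+n; +-suc; ≰⇒>; m+[n∸m]≡n; ∸-mono; ∸-monoʳ-<;
         ∣m-n∣≡[m∸n]∨[n∸m]; module ≤-Reasoning)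
open import Data.Fin using () renaming (_≟_ to _≟ᶠ_)
open import Data.Fin.Properties using (<⇒≢; <-irrefl)
open import Data.Fin.Subset using (inside; outside; _∉_; _⊆_; ⁅_⁆; _∪_; _─_)
open import Data.Fin.Subset.Properties
  using (_∈?_; p⊆q⇒∣p∣≤∣q∣; x∈p∪q⁻; x∈p∪q⁺; x∈⁅x⁆; x∈⁅y⁆⇒x≡y; x∉⁅y⁆⇒x≢y; ∣⁅x⁆∣≡1; ∪-identityˡ;
         p─q⊆p; x∈p∧x≢y⇒x∈p-y; x∈p⇒∣p-x∣<∣p∣)
open import Data.Vec.Base using ([]; _∷_; here; there)
open import Data.Product using (Σ-syntax; ∃; _×_; _,_; proj₁; proj₂)
open import Data.Sum using (_⊎_; inj₁; inj₂; [_,_]′)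
import Data.Sum as Sum
open import Data.Empty using (⊥-elim)
open import Function using (_∘_)
open import Function.Bundles using (Equivalence)
open import Relation.Nullary using (¬_; yes; no)
open import Relation.Nullary.Decidable using (decidable-stable; _×-dec_)
open import Relation.Binary.PropositionalEquality using (_≡_; _≢_; refl; sym; trans; cong; subst)

private
  variable
    a b k m n : ℕ
    x y z : Fin n
    p S T : Subset n
    col i : Colour
    c : Colouring n

x∈p─q⇒x∉q : ∀ (p q : Subset n) → x ∈ p ─ q → x ∉ q
x∈p─q⇒x∉q (_ ∷ p) (outside ∷ q) here        ()
x∈p─q⇒x∉q (_ ∷ p) (_ ∷ q)       (there x∈p─q) (there x∈q) = x∈p─q⇒x∉q p q x∈p─q x∈q

x∈p-y⁻ : x ∈ p ─ ⁅ y ⁆ → x ∈ p × x ≢ y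
x∈p-y⁻ {p = p} {y = y} x∈p-y =
  p─q⊆p p ⁅ y ⁆ x∈p-y , x∉⁅y⁆⇒x≢y (x∈p─q⇒x∉q p ⁅ y ⁆ x∈p-y)

∈⁅x⁆∪⁅y⁆⁻ : z ∈ ⁅ x ⁆ ∪ ⁅ y ⁆ → z ≡ x ⊎ z ≡ y
∈⁅x⁆∪⁅y⁆⁻ {x = x} {y = y} z∈ = Sum.map (x∈⁅y⁆⇒x≡y x) (x∈⁅y⁆⇒x≡y y) (x∈p∪q⁻ ⁅ x ⁆ ⁅ y ⁆ z∈)

⁅x⁆∪⁅y⁆⊆p : x ∈ p → y ∈ p → ⁅ x ⁆ ∪ ⁅ y ⁆ ⊆ p
⁅x⁆∪⁅y⁆⊆p x∈p y∈p z∈ with ∈⁅x⁆∪⁅y⁆⁻ z∈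
... | inj₁ refl = x∈p
... | inj₂ refl = y∈p

∣⁅x⁆∪p∣≡1+∣p∣ : x ∉ p → ∣ ⁅ x ⁆ ∪ p ∣ ≡ N.suc ∣ p ∣
∣⁅x⁆∪p∣≡1+∣p∣ {x = zero}  {p = inside ∷ p}  x∉p = ⊥-elim (x∉p here)
∣⁅x⁆∪p∣≡1+∣p∣ {x = zero}  {p = outside ∷ p} x∉p = cong (N.suc ∘ ∣_∣) (∪-identityˡ p)
∣⁅x⁆∪p∣≡1+∣p∣ {x = suc x} {p = inside ∷ p}  x∉p = cong N.suc (∣⁅x⁆∪p∣≡1+∣p∣ (x∉p ∘ there))
∣⁅x⁆∪p∣≡1+∣p∣ {x = suc x} {p = outside ∷ p} x∉p = ∣⁅x⁆∪p∣≡1+∣p∣ (x∉p ∘ there)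

∣p∣≤∣q∣+∣p─q∣ : ∀ (p q : Subset n) → ∣ p ∣ ≤ ∣ q ∣ N.+ ∣ p ─ q ∣
∣p∣≤∣q∣+∣p─q∣ []            []            = z≤n
∣p∣≤∣q∣+∣p─q∣ (inside ∷ p)  (inside ∷ q)  = s≤s (∣p∣≤∣q∣+∣p─q∣ p q)
∣p∣≤∣q∣+∣p─q∣ (inside ∷ p)  (outside ∷ q) =
  ≤-trans (s≤s (∣p∣≤∣q∣+∣p─q∣ p q)) (≤-reflexive (sym (+-suc ∣ q ∣ ∣ p ─ q ∣)))
∣p∣≤∣q∣+∣p─q∣ (outside ∷ p) (inside ∷ q)  = ≤-trans (∣p∣≤∣q∣+∣p─q∣ p q) (n≤1+n _)
∣p∣≤∣q∣+∣p─q∣ (outside ∷ p) (outside ∷ q) = ∣p∣≤∣q∣+∣p─q∣ p q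

∣p∣≤1+∣p-x∣ : ∀ (p : Subset n) x → ∣ p ∣ ≤ N.suc ∣ p ─ ⁅ x ⁆ ∣
∣p∣≤1+∣p-x∣ p x =
  ≤-trans (∣p∣≤∣q∣+∣p─q∣ p ⁅ x ⁆) (≤-reflexive (cong (N._+ ∣ p ─ ⁅ x ⁆ ∣) (∣⁅x⁆∣≡1 x)))

2≤∣p∣ : x ∈ p → y ∈ p → x ≢ y → 2 ≤ ∣ p ∣
2≤∣p∣ x∈p y∈p x≢y =
  ≤-trans (s≤s (≤-trans (s≤s z≤n) (x∈p⇒∣p-x∣<∣p∣ (x∈p∧x≢y⇒x∈p-y y∈p (x≢y ∘ sym)))))
          (x∈p⇒∣p-x∣<∣p∣ x∈p)

MonoClique-⊆ : S ⊆ T → MonoClique c col T → MonoClique c col S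
MonoClique-⊆ S⊆T mono x y x∈S y∈S = mono x y (S⊆T x∈S) (S⊆T y∈S)

MonoClique-⁅x⁆∪ : MonoClique c col S → (∀ {y} → y ∈ S → MonoClique c col (⁅ x ⁆ ∪ ⁅ y ⁆)) →
                  MonoClique c col (⁅ x ⁆ ∪ S)
MonoClique-⁅x⁆∪ {S = S} {x = x} mono joined y z y∈ z∈ y<z
  with x∈p∪q⁻ ⁅ x ⁆ S y∈ | x∈p∪q⁻ ⁅ x ⁆ S z∈
... | inj₁ y∈⁅x⁆ | inj₁ z∈⁅x⁆ =
  ⊥-elim (<-irrefl (trans (x∈⁅y⁆⇒x≡y x y∈⁅x⁆) (sym (x∈⁅y⁆⇒x≡y x z∈⁅x⁆))) y<z)
... | inj₁ y∈⁅x⁆ | inj₂ z∈S  = joined z∈S y z (x∈p∪q⁺ (inj₁ y∈⁅x⁆)) (x∈p∪q⁺ (inj₂ (x∈⁅x⁆ z))) y<z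
... | inj₂ y∈S  | inj₁ z∈⁅x⁆ = joined y∈S y z (x∈p∪q⁺ (inj₂ (x∈⁅x⁆ y))) (x∈p∪q⁺ (inj₁ z∈⁅x⁆)) y<z
... | inj₂ y∈S  | inj₂ z∈S  = mono y z y∈S z∈S y<z

HasMonoKWithin : Colouring n → Colour → ℕ → Subset n → Set
HasMonoKWithin {n} c col k T = Σ[ S ∈ Subset n ] ∣ S ∣ ≡ k × MonoClique c col S × S ⊆ T

-- Order-preserving embeddings: MonoClique only reads c x y for x < y, so a restriction of a
-- colouring must keep the order of the vertices.
data Thinning : ℕ → ℕ → Set where
  done : Thinning 0 0
  skip : Thinning m n → Thinning m (N.suc n)
  keep : Thinning m n → Thinning (N.suc m) (N.suc n)

embed : Thinning m n → Fin m → Fin n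
embed (skip θ) x       = suc (embed θ x)
embed (keep θ) zero    = zero
embed (keep θ) (suc x) = suc (embed θ x)

image : Thinning m n → Subset m → Subset n
image done     []      = []
image (skip θ) p       = outside ∷ image θ p
image (keep θ) (b ∷ p) = b ∷ image θ p

restrict : Colouring n → Thinning m n → Colouring m
restrict c θ x y = c (embed θ x) (embed θ y)

∣image∣≡∣p∣ : ∀ (θ : Thinning m n) p → ∣ image θ p ∣ ≡ ∣ p ∣
∣image∣≡∣p∣ done     []            = refl
∣image∣≡∣p∣ (skip θ) p             = ∣image∣≡∣p∣ θ p
∣image∣≡∣p∣ (keep θ) (outside ∷ p) = ∣image∣≡∣p∣ θ p
∣image∣≡∣p∣ (keep θ) (inside ∷ p)  = cong N.suc (∣image∣≡∣p∣ θ p)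

∈-image⁻ : ∀ (θ : Thinning m n) p → x ∈ image θ p → ∃ λ y → y ∈ p × embed θ y ≡ x
∈-image⁻ (skip θ) p       (there x∈) with ∈-image⁻ θ p x∈
... | y , y∈p , refl = y , y∈p , refl
∈-image⁻ (keep θ) (b ∷ p) here = zero , here , refl
∈-image⁻ (keep θ) (b ∷ p) (there x∈) with ∈-image⁻ θ p x∈
... | y , y∈p , refl = suc y , there y∈p , refl

embed-reflects-< : ∀ (θ : Thinning m n) → embed θ x < embed θ y → x < y
embed-reflects-< {x = x}     {y = y}     (skip θ) (s≤s θx<θy) = embed-reflects-< θ θx<θy
embed-reflects-< {x = zero}  {y = suc y} (keep θ) _           = s≤s z≤n
embed-reflects-< {x = suc x} {y = suc y} (keep θ) (s≤s θx<θy) = s≤s (embed-reflects-< θ θx<θy)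

image-MonoClique : ∀ (θ : Thinning m n) → MonoClique (restrict c θ) col p → MonoClique c col (image θ p)
image-MonoClique {p = p} θ mono x y x∈ y∈ x<y with ∈-image⁻ θ p x∈ | ∈-image⁻ θ p y∈
... | x′ , x′∈p , refl | y′ , y′∈p , refl = mono x′ y′ x′∈p y′∈p (embed-reflects-< θ x<y)

image⊆ : ∀ (θ : Thinning m n) → (∀ x → embed θ x ∈ T) → image θ p ⊆ T
image⊆ {p = p} θ θ⊆T x∈ with ∈-image⁻ θ p x∈
... | y , _ , refl = θ⊆T y

thinningInto : ∀ (T : Subset n) → m ≤ ∣ T ∣ → Σ[ θ ∈ Thinning m n ] ∀ x → embed θ x ∈ T
thinningInto {m = N.zero} [] _ = done , λ ()
thinningInto {m = N.zero} (_ ∷ T) _ with thinningInto T z≤n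
... | θ , θ⊆T = skip θ , there ∘ θ⊆T
thinningInto {m = N.suc m} (outside ∷ T) m≤∣T∣ with thinningInto T m≤∣T∣
... | θ , θ⊆T = skip θ , there ∘ θ⊆T
thinningInto {m = N.suc m} (inside ∷ T) (s≤s m≤∣T∣) with thinningInto T m≤∣T∣
... | θ , θ⊆T = keep θ , λ { zero → here ; (suc x) → there (θ⊆T x) }

arrowsWithin : Arrows a b m → ∀ (c : Colouring n) T → m ≤ ∣ T ∣ →
               HasMonoKWithin c zero a T ⊎ HasMonoKWithin c (suc zero) b T
arrowsWithin arrows c T m≤∣T∣ with thinningInto T m≤∣T∣
... | θ , θ⊆T = Sum.map push push (arrows (restrict c θ))
  where
  push : HasMonoK (restrict c θ) col k → HasMonoKWithin c col k T
  push (S , ∣S∣≡k , mono) =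
    image θ S , trans (∣image∣≡∣p∣ θ S) ∣S∣≡k , image-MonoClique θ mono , image⊆ θ θ⊆T

other : Colour → Colour
other zero       = suc zero
other (suc zero) = zero

relabel : Colour → Colour → Colour
relabel i zero       = i
relabel i (suc zero) = other i

relabel-involutive : ∀ i col → relabel i (relabel i col) ≡ col
relabel-involutive zero       zero       = refl
relabel-involutive zero       (suc zero) = refl
relabel-involutive (suc zero) zero       = refl
relabel-involutive (suc zero) (suc zero) = refl

HasMonoKWithin-relabel : HasMonoKWithin (λ x y → relabel i (c x y)) col k T →
                         HasMonoKWithin c (relabel i col) k T
HasMonoKWithin-relabel {i = i} {c = c} (S , ∣S∣≡k , mono , S⊆T) =
  S , ∣S∣≡k , (λ x y x∈ y∈ x<y →
    trans (sym (relabel-involutive i (c x y))) (cong (relabel i) (mono x y x∈ y∈ x<y))) , S⊆T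

arrowsWithin-relabelled : Arrows a b m → ∀ i (c : Colouring n) T → m ≤ ∣ T ∣ →
                          HasMonoKWithin c i a T ⊎ HasMonoKWithin c (other i) b T
arrowsWithin-relabelled arrows i c T m≤∣T∣ =
  Sum.map HasMonoKWithin-relabel HasMonoKWithin-relabel
    (arrowsWithin arrows (λ x y → relabel i (c x y)) T m≤∣T∣)

extend-uv : ∀ (c : Colouring n) u v i → extend c u v i u v ≡ i
extend-uv c u v i with u ≟ᶠ u | v ≟ᶠ v
... | yes _  | yes _  = refl
... | no u≢u | _      = ⊥-elim (u≢u refl)
... | yes _  | no v≢v = ⊥-elim (v≢v refl)

MonoClique-extend⁻ : ∀ {u v} → ¬ (u ∈ S × v ∈ S) → MonoClique (extend c u v i) col S → MonoClique c col S
MonoClique-extend⁻ {c = c} {u = u} {v = v} e⊈S mono x y x∈S y∈S x<y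
  with x ≟ᶠ u | y ≟ᶠ v | mono x y x∈S y∈S x<y
... | yes refl | yes refl | _        = ⊥-elim (e⊈S (x∈S , y∈S))
... | yes _    | no _     | cxy≡col = cxy≡col
... | no _     | yes _    | cxy≡col = cxy≡col
... | no _     | no _     | cxy≡col = cxy≡col

module CriticalColouring {s n} {u v : Fin n} (u<v : u < v) (c : Colouring n)
                         (noMonoKs : NoMonoKsMinusEdge s c u v) (arrows : Arrows s s n) where

  u≢v : u ≢ v
  u≢v = <⇒≢ u<v

  monoKs-contains-e : ∣ S ∣ ≡ s → MonoClique (extend c u v i) col S → u ∈ S × v ∈ S
  monoKs-contains-e {S = S} ∣S∣≡s mono = decidable-stable (u ∈? S ×-dec v ∈? S)
    λ e⊈S → noMonoKs S _ ∣S∣≡s e⊈S (MonoClique-extend⁻ e⊈S mono)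

  MonoKsThroughE : Colour → Set
  MonoKsThroughE i = Σ[ S ∈ Subset n ] ∣ S ∣ ≡ s × u ∈ S × v ∈ S × MonoClique (extend c u v i) i S

  monoKs-through-e : ∀ i → MonoKsThroughE i
  monoKs-through-e i = [ through , through ]′ (arrows (extend c u v i))
    where
    through : HasMonoK (extend c u v i) col s → MonoKsThroughE i
    through (S , ∣S∣≡s , mono) =
      let u∈S , v∈S = monoKs-contains-e ∣S∣≡s mono
          col≡i     = trans (sym (mono u v u∈S v∈S u<v)) (extend-uv c u v i)
      in  S , ∣S∣≡s , u∈S , v∈S , subst (λ col → MonoClique (extend c u v i) col S) col≡i mono

  2≤s : 2 ≤ s
  2≤s = let S , ∣S∣≡s , u∈S , v∈S , _ = monoKs-through-e zero
        in  subst (2 ≤_) ∣S∣≡s (2≤∣p∣ u∈S v∈S u≢v)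

  module G (i : Colour) (V : Subset n) (V⇔G : ∀ w → (w ∈ V) ⇔ InG s c u v i w) where

    s≤∣V∣ : s ≤ ∣ V ∣
    s≤∣V∣ = let S , ∣S∣≡s , u∈S , v∈S , mono = monoKs-through-e i
            in  subst (_≤ ∣ V ∣) ∣S∣≡s (p⊆q⇒∣p∣≤∣q∣ λ {w} w∈S →
                  Equivalence.from (V⇔G w) (S , ∣S∣≡s , u∈S , v∈S , w∈S , mono))

    V-e : Subset n
    V-e = V ─ ⁅ u ⁆ ─ ⁅ v ⁆

    ∈V-e⁻ : x ∈ V-e → x ∈ V × x ≢ u × x ≢ v
    ∈V-e⁻ x∈V-e = let x∈V-u , x≢v = x∈p-y⁻ x∈V-e
                      x∈V   , x≢u = x∈p-y⁻ x∈V-u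
                  in  x∈V , x≢u , x≢v

    u∉V-e : u ∉ V-e
    u∉V-e u∈V-e = proj₁ (proj₂ (∈V-e⁻ u∈V-e)) refl

    v∉V-e : v ∉ V-e
    v∉V-e v∈V-e = proj₂ (proj₂ (∈V-e⁻ v∈V-e)) refl

    -- The edge uw lies on a colour-i K_s through e, and is not e itself.
    u-joined : ∀ {w} → w ∈ V-e → MonoClique c i (⁅ u ⁆ ∪ ⁅ w ⁆)
    u-joined {w} w∈V-e =
      let w∈V , _ , w≢v                = ∈V-e⁻ w∈V-e
          S , _ , u∈S , _ , w∈S , mono = Equivalence.to (V⇔G w) w∈V
          e⊈uw : ¬ (u ∈ ⁅ u ⁆ ∪ ⁅ w ⁆ × v ∈ ⁅ u ⁆ ∪ ⁅ w ⁆)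
          e⊈uw = λ (_ , v∈uw) → [ u≢v ∘ sym , w≢v ∘ sym ]′ (∈⁅x⁆∪⁅y⁆⁻ v∈uw)
      in  MonoClique-extend⁻ e⊈uw (MonoClique-⊆ (⁅x⁆∪⁅y⁆⊆p u∈S w∈S) mono)

    no-K[s-1]-within-V-e : ¬ HasMonoKWithin c i (s ∸ 1) V-e
    no-K[s-1]-within-V-e (S , ∣S∣≡s-1 , mono , S⊆V-e) =
      noMonoKs (⁅ u ⁆ ∪ S) i ∣u+S∣≡s (λ (_ , v∈u+S) → v∉u+S v∈u+S) (MonoClique-⁅x⁆∪ mono (u-joined ∘ S⊆V-e))
      where
      ∣u+S∣≡s : ∣ ⁅ u ⁆ ∪ S ∣ ≡ s
      ∣u+S∣≡s = trans (∣⁅x⁆∪p∣≡1+∣p∣ (u∉V-e ∘ S⊆V-e))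
                      (trans (cong N.suc ∣S∣≡s-1) (m+[n∸m]≡n (≤-trans (s≤s z≤n) 2≤s)))
      v∉u+S : v ∉ ⁅ u ⁆ ∪ S
      v∉u+S v∈u+S = [ u≢v ∘ sym ∘ x∈⁅y⁆⇒x≡y u , v∉V-e ∘ S⊆V-e ]′ (x∈p∪q⁻ ⁅ u ⁆ S v∈u+S)

    no-Ks-within-V-e : ¬ HasMonoKWithin c col s V-e
    no-Ks-within-V-e (S , ∣S∣≡s , mono , S⊆V-e) =
      noMonoKs S _ ∣S∣≡s (λ (u∈S , _) → u∉V-e (S⊆V-e u∈S)) mono

    ∣V-e∣<r : ∀ {r} → Arrows (s ∸ 1) s r → ∣ V-e ∣ N.< r
    ∣V-e∣<r arrows′ = ≰⇒> λ r≤∣V-e∣ →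
      [ no-K[s-1]-within-V-e , no-Ks-within-V-e ]′ (arrowsWithin-relabelled arrows′ i c V-e r≤∣V-e∣)

    ∣V∣≤1+r : ∀ {r} → Arrows (s ∸ 1) s r → ∣ V ∣ ≤ N.suc r
    ∣V∣≤1+r {r} arrows′ = begin
      ∣ V ∣                  ≤⟨ ∣p∣≤1+∣p-x∣ V u ⟩
      N.suc ∣ V ─ ⁅ u ⁆ ∣    ≤⟨ s≤s (∣p∣≤1+∣p-x∣ (V ─ ⁅ u ⁆) v) ⟩
      N.suc (N.suc ∣ V-e ∣)  ≤⟨ s≤s (∣V-e∣<r arrows′) ⟩
      N.suc r                ∎
      where open ≤-Reasoning

∣m-n∣≤h∸l : ∀ {l m n h} → l ≤ m → l ≤ n → m ≤ h → n ≤ h → ∣ m - n ∣ ≤ h ∸ l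
∣m-n∣≤h∸l {m = m} {n} l≤m l≤n m≤h n≤h with ∣m-n∣≡[m∸n]∨[n∸m] m n
... | inj₁ ∣m-n∣≡m∸n = subst (_≤ _) (sym ∣m-n∣≡m∸n) (∸-mono m≤h l≤n)
... | inj₂ ∣m-n∣≡n∸m = subst (_≤ _) (sym ∣m-n∣≡n∸m) (∸-mono n≤h l≤m)

1+r∸s<r∸[s∸2] : ∀ {r s} → 2 ≤ s → s ≤ N.suc r → N.suc r ∸ s N.< r ∸ (s ∸ 2)
1+r∸s<r∸[s∸2] {r} {N.suc (N.suc t)} (s≤s (s≤s z≤n)) (s≤s 1+t≤r) = ∸-monoʳ-< {r} ≤-refl 1+t≤r

lemma3p3 : (s n r : ℕ) → IsRamsey s s n → IsRamsey (s ∸ 1) s r →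
    (u v : Fin n) → u < v → (c : Colouring n) → NoMonoKsMinusEdge s c u v →
    (V₁ V₂ : Subset n) →
    (∀ w → (w ∈ V₁) ⇔ InG s c u v zero w) →
    (∀ w → (w ∈ V₂) ⇔ InG s c u v (suc zero) w) →
    ∣ ∣ V₁ ∣ - ∣ V₂ ∣ ∣ N.< r ∸ (s ∸ 2)
lemma3p3 s n r (arrows , _) (arrows′ , _) u v u<v c noMonoKs V₁ V₂ V₁⇔G₁ V₂⇔G₂ =
  ≤-<-trans (∣m-n∣≤h∸l G₁.s≤∣V∣ G₂.s≤∣V∣ (G₁.∣V∣≤1+r arrows′) (G₂.∣V∣≤1+r arrows′))
            (1+r∸s<r∸[s∸2] 2≤s (≤-trans G₁.s≤∣V∣ (G₁.∣V∣≤1+r arrows′)))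
  where
  open CriticalColouring u<v c noMonoKs arrows
  module G₁ = G zero V₁ V₁⇔G₁
  module G₂ = G (suc zero) V₂ V₂⇔G₂
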